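{- The theory $Q^\backsim$ strengthens $R^\backsim$ in the first-order logic $\mathrm{QSL}_w$, i.e. $Q^\backsim\vdash_{\mathrm{QSL}_w}\varphi$ for every axiom $\varphi$ of $R^\backsim$.
   Context: Propositional logic $\mathrm{SL}_w$ in the language $\to,\wedge,\vee,\bot$ (with $\neg\varphi:=\varphi\to\bot$, $\varphi\leftrightarrow\psi:=(\varphi\to\psi)\wedge(\psi\to\varphi)$), given by axioms: $\varphi\to\varphi$; $(\varphi\wedge\psi)\to\varphi$; $(\varphi\wedge\psi)\to\psi$; $((\varphi\to\psi)\wedge(\varphi\to\chi))\to(\varphi\to\psi\wedge\chi)$; $\varphi\to(\varphi\vee\psi)$; $\psi\to(\varphi\vee\psi)$; $(\varphi\to\chi)\wedge(\psi\to\chi)\to(\varphi\vee\psi\to\chi)$; $\varphi\to(\psi\to\varphi)$; $\bot\to\varphi$; and rules: $\varphi,\varphi\to\psi\rhd\psi$; $\varphi,\psi\rhd\varphi\wedge\psi$; $\varphi\to\psi,\chi\to\theta\rhd(\psi\to\chi)\to(\varphi\to\theta)$; $\varphi\rhd(\varphi\to\psi)\to\psi$. $\mathrm{QSL}_w$ is the first-order logic axiomatised by all substitution instances (atoms replaced by first-order formulas) of the axioms/rules of $\mathrm{SL}_w$ plus: $(\forall x)\varphi(x)\to\varphi(t)$; $\varphi(t)\to(\exists x)\varphi(x)$; $\chi\to\psi\rhd\chi\to(\forall x)\psi$; $\psi\to\chi\rhd(\exists x)\psi\to\chi$ ($t$ substitutable for $x$, $x$ not free in $\chi$); $x=x$;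 $x=y\to y=x$; $x=y\to(y=z\to x=z)$; $x=y\to t(x)=t(y)$; $x=y\to(\varphi(x)\to\varphi(y))$. Write $t\neq s$ for $\neg(t=s)$. Arithmetical language: constant $\overline{0}$, unary $S$, binary $=,\leq$, ternary $A,M$; numerals $\overline{n}=S\cdots S(\overline{0})$ ($n$ times). $R^\backsim$: axioms $A(\overline{m},\overline{n},x)\leftrightarrow\overline{m+n}=x$; $M(\overline{m},\overline{n},x)\leftrightarrow\overline{m\cdot n}=x$; $\overline{m}\neq\overline{n}$ for $m\neq n$; $x\leq\overline{n}\leftrightarrow(x=\overline{0}\vee x=\overline{1}\vee\dots\vee x=\overline{n})$; $x\leq\overline{n}\vee\overline{n}\leq x$; $x\leq\overline{n}\vee\neg(x\leq\overline{n})$ (for all $m,n\in\mathbb{N}$). $Q^\backsim$: axioms $x=y\vee x\neq y$; $S(x)\neq\overline{0}$; $S(x)=S(y)\to x=y$; $x\neq\overline{0}\to(\exists y)(x=S(y))$; $A(x,\overline{0},y)\leftrightarrow x=y$; $A(x,S(y),z)\leftrightarrow(\exists u)(A(x,y,u)\wedge z=S(u))$; $M(x,\overline{0},y)\leftrightarrow y=\overline{0}$; $M(x,S(y),z)\to(\exists u)(M(x,y,u)\wedge A(u,x,z))$; $M(\overline{m},\overline{n},u)\to(A(u,\overline{n},x)\to M(\overline{m},\overline{n+1},x))$ for all $m,n$; $x\leq y\leftrightarrow(\exists z)A(z,x,y)$. -}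

module Defs where

open import Data.Nat using (ℕ; zero; suc; _+_; _*_; _≡ᵇ_)
open import Data.Bool using (Bool; true; false; _∧_; _∨_; not; if_then_else_; T)
open import Relation.Nullary using (¬_)
open import Relation.Binary.PropositionalEquality using (_≡_)

data Term : Set where
  var : ℕ → Term
  𝟘   : Term
  S   : Term → Term

infixr 4 _⇒_
infixr 5 _∨'_
infixr 6 _∧'_
infix  7 _≐_ _≼_

data Fm : Set where
  _≐_ _≼_   : Term → Term → Fm
  A M       : Term → Term → Term → Fm
  ⊥'        : Fm
  _⇒_ _∧'_ _∨'_ : Fm → Fm → Fm
  ∀' ∃'     : ℕ → Fm → Fm

¬' : Fm → Fm
¬' φ = φ ⇒ ⊥'

_⇔_ : Fm → Fm → Fm
φ ⇔ ψ = (φ ⇒ ψ) ∧' (ψ ⇒ φ)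
infix 3 _⇔_

_≠_ : Term → Term → Fm
t ≠ s = ¬' (t ≐ s)
infix 7 _≠_

num : ℕ → Term
num zero    = 𝟘
num (suc n) = S (num n)

occT : ℕ → Term → Bool
occT x (var y) = x ≡ᵇ y
occT x 𝟘       = false
occT x (S t)   = occT x t

free : ℕ → Fm → Bool
free x (t ≐ s)   = occT x t ∨ occT x s
free x (t ≼ s)   = occT x t ∨ occT x s
free x (A t s u) = occT x t ∨ occT x s ∨ occT x u
free x (M t s u) = occT x t ∨ occT x s ∨ occT x u
free x ⊥'        = false
free x (φ ⇒ ψ)   = free x φ ∨ free x ψ
free x (φ ∧' ψ)  = free x φ ∨ free x ψ
free x (φ ∨' ψ)  = free x φ ∨ free x ψ
free x (∀' y φ)  = if y ≡ᵇ x then false else free x φ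
free x (∃' y φ)  = if y ≡ᵇ x then false else free x φ

substT : ℕ → Term → Term → Term
substT x t (var y) = if x ≡ᵇ y then t else var y
substT x t 𝟘       = 𝟘
substT x t (S s)   = S (substT x t s)

sub : ℕ → Term → Fm → Fm
sub x t (a ≐ b)   = substT x t a ≐ substT x t b
sub x t (a ≼ b)   = substT x t a ≼ substT x t b
sub x t (A a b c) = A (substT x t a) (substT x t b) (substT x t c)
sub x t (M a b c) = M (substT x t a) (substT x t b) (substT x t c)
sub x t ⊥'        = ⊥'
sub x t (φ ⇒ ψ)   = sub x t φ ⇒ sub x t ψ
sub x t (φ ∧' ψ)  = sub x t φ ∧' sub x t ψ
sub x t (φ ∨' ψ)  = sub x t φ ∨' sub x t ψ
sub x t (∀' y φ)  = if y ≡ᵇ x then ∀' y φ else ∀' y (sub x t φ)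
sub x t (∃' y φ)  = if y ≡ᵇ x then ∃' y φ else ∃' y (sub x t φ)

substitutable : Term → ℕ → Fm → Bool
substitutable t x (φ ⇒ ψ)  = substitutable t x φ ∧ substitutable t x ψ
substitutable t x (φ ∧' ψ) = substitutable t x φ ∧ substitutable t x ψ
substitutable t x (φ ∨' ψ) = substitutable t x φ ∧ substitutable t x ψ
substitutable t x (∀' y φ) =
  not (free x (∀' y φ)) ∨ (not (occT y t) ∧ substitutable t x φ)
substitutable t x (∃' y φ) =
  not (free x (∃' y φ)) ∨ (not (occT y t) ∧ substitutable t x φ)
substitutable t x _        = true

infix 2 _⊢_

data _⊢_ (Th : Fm → Set) : Fm → Set where
  ax      : ∀ {φ} → Th φ → Th ⊢ φ
  id-ax   : ∀ φ → Th ⊢ φ ⇒ φ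
  ∧-e₁    : ∀ φ ψ → Th ⊢ (φ ∧' ψ) ⇒ φ
  ∧-e₂    : ∀ φ ψ → Th ⊢ (φ ∧' ψ) ⇒ ψ
  ∧-i     : ∀ φ ψ χ → Th ⊢ ((φ ⇒ ψ) ∧' (φ ⇒ χ)) ⇒ (φ ⇒ ψ ∧' χ)
  ∨-i₁    : ∀ φ ψ → Th ⊢ φ ⇒ (φ ∨' ψ)
  ∨-i₂    : ∀ φ ψ → Th ⊢ ψ ⇒ (φ ∨' ψ)
  ∨-e     : ∀ φ ψ χ → Th ⊢ ((φ ⇒ χ) ∧' (ψ ⇒ χ)) ⇒ (φ ∨' ψ ⇒ χ)
  K-ax    : ∀ φ ψ → Th ⊢ φ ⇒ (ψ ⇒ φ)
  ⊥-ax    : ∀ φ → Th ⊢ ⊥' ⇒ φ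
  mp      : ∀ {φ ψ} → Th ⊢ φ → Th ⊢ φ ⇒ ψ → Th ⊢ ψ
  adj     : ∀ {φ ψ} → Th ⊢ φ → Th ⊢ ψ → Th ⊢ φ ∧' ψ
  pref    : ∀ {φ ψ χ θ} → Th ⊢ φ ⇒ ψ → Th ⊢ χ ⇒ θ → Th ⊢ (ψ ⇒ χ) ⇒ (φ ⇒ θ)
  assert  : ∀ {φ} ψ → Th ⊢ φ → Th ⊢ (φ ⇒ ψ) ⇒ ψ
  ∀-inst  : ∀ x φ t → T (substitutable t x φ) → Th ⊢ ∀' x φ ⇒ sub x t φ
  ∃-intro : ∀ x φ t → T (substitutable t x φ) → Th ⊢ sub x t φ ⇒ ∃' x φ
  ∀-gen   : ∀ {χ ψ} x → T (not (free x χ)) → Th ⊢ χ ⇒ ψ → Th ⊢ χ ⇒ ∀' x ψ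
  ∃-gen   : ∀ {χ ψ} x → T (not (free x χ)) → Th ⊢ ψ ⇒ χ → Th ⊢ ∃' x ψ ⇒ χ
  eq-refl  : ∀ x → Th ⊢ var x ≐ var x
  eq-sym   : ∀ x y → Th ⊢ var x ≐ var y ⇒ var y ≐ var x
  eq-trans : ∀ x y z → Th ⊢ var x ≐ var y ⇒ (var y ≐ var z ⇒ var x ≐ var z)
  eq-term  : ∀ x y t → Th ⊢ var x ≐ var y ⇒ t ≐ substT x (var y) t
  eq-leib  : ∀ x y φ → T (substitutable (var y) x φ) →
             Th ⊢ var x ≐ var y ⇒ (φ ⇒ sub x (var y) φ)

vx vy vz vu : Term
vx = var 0
vy = var 1
vz = var 2
vu = var 3

upToDisj : Term → ℕ → Fm
upToDisj t zero    = t ≐ num zero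
upToDisj t (suc n) = upToDisj t n ∨' (t ≐ num (suc n))

data RAx : Fm → Set where
  R-add  : ∀ m n → RAx (A (num m) (num n) vx ⇔ num (m + n) ≐ vx)
  R-mul  : ∀ m n → RAx (M (num m) (num n) vx ⇔ num (m * n) ≐ vx)
  R-neq  : ∀ m n → ¬ (m ≡ n) → RAx (num m ≠ num n)
  R-le   : ∀ n → RAx (vx ≼ num n ⇔ upToDisj vx n)
  R-tot  : ∀ n → RAx (vx ≼ num n ∨' num n ≼ vx)
  R-dec  : ∀ n → RAx (vx ≼ num n ∨' ¬' (vx ≼ num n))

data QAx : Fm → Set where
  Q-dec   : QAx (vx ≐ vy ∨' vx ≠ vy)
  Q-S0    : QAx (S vx ≠ 𝟘)
  Q-Sinj  : QAx (S vx ≐ S vy ⇒ vx ≐ vy)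
  Q-pred  : QAx (vx ≠ 𝟘 ⇒ ∃' 1 (vx ≐ S vy))
  Q-A0    : QAx (A vx 𝟘 vy ⇔ vx ≐ vy)
  Q-AS    : QAx (A vx (S vy) vz ⇔ ∃' 3 (A vx vy vu ∧' vz ≐ S vu))
  Q-M0    : QAx (M vx 𝟘 vy ⇔ vy ≐ 𝟘)
  Q-MS    : QAx (M vx (S vy) vz ⇒ ∃' 3 (M vx vy vu ∧' A vu vx vz))
  Q-Mnum  : ∀ m n → QAx (M (num m) (num n) vu ⇒ (A vu (num m) vx ⇒ M (num m) (num (suc n)) vx))
  Q-le    : QAx (vx ≼ vy ⇔ ∃' 2 (A vz vx vy))

module Submission where

-- QSL_w has no deduction theorem and no import/export law, so every
-- derivation is built from a small kit of derived Hilbert-style rules.  The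
-- one non-classical obstacle is that a hypothesis (e ∧ d ⇒ c) cannot in
-- general be obtained from (e ⇒ (d ⇒ c)); it can when e is decidable
-- (e ∨ ¬e), and Q^∽ makes equality decidable.
--
-- Variables 0,1,2,3 are the x,y,z,u of the axioms; variables 10,11,12 serve
-- as auxiliary variables when an axiom is instantiated at several terms.

open import Defs
open import Data.Nat using (ℕ; zero; suc; _+_; _*_; _∸_; _≤_; z≤n; _≡ᵇ_)
open import Data.Nat.Properties using (<⇒≤; ≤-refl; +-suc; +-identityʳ; *-suc; *-zeroʳ; +-comm; m∸n+n≡m)
open import Data.Bool using (Bool; true; false; _∧_; not)
open import Data.Bool.Properties using (∨-zeroʳ; T-≡; T-not-≡)
open import Data.Product using (_×_; _,_)
open import Function.Bundles using (Equivalence)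
open import Relation.Nullary using (¬_)
open import Relation.Binary.PropositionalEquality using (_≡_; refl; sym; trans; cong; subst)

Pf : Fm → Set
Pf φ = QAx ⊢ φ

chain : ∀ {a b c} → Pf (a ⇒ b) → Pf (b ⇒ c) → Pf (a ⇒ c)
chain ab bc = mp bc (pref ab (id-ax _))

both : ∀ {a b c} → Pf (a ⇒ b) → Pf (a ⇒ c) → Pf (a ⇒ b ∧' c)
both p q = mp (adj p q) (∧-i _ _ _)

either : ∀ {a b c} → Pf (a ⇒ c) → Pf (b ⇒ c) → Pf (a ∨' b ⇒ c)
either p q = mp (adj p q) (∨-e _ _ _)

∧-map : ∀ {a b c d} → Pf (a ⇒ c) → Pf (b ⇒ d) → Pf (a ∧' b ⇒ c ∧' d)
∧-map p q = both (chain (∧-e₁ _ _) p) (chain (∧-e₂ _ _) q)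

weaken : ∀ {a b} → Pf a → Pf (b ⇒ a)
weaken p = mp p (K-ax _ _)

precompose : ∀ {a a' b} → Pf (a' ⇒ a) → Pf ((a ⇒ b) ⇒ (a' ⇒ b))
precompose p = pref p (id-ax _)

under : ∀ {e a b c} → Pf (e ⇒ (a ⇒ b)) → Pf (b ⇒ c) → Pf (e ⇒ (a ⇒ c))
under p q = chain p (pref (id-ax _) q)

discharge : ∀ {e a c} → Pf (e ⇒ (a ⇒ c)) → Pf a → Pf (e ⇒ c)
discharge p a = chain p (assert _ a)

fwd : ∀ {a b} → Pf (a ⇔ b) → Pf (a ⇒ b)
fwd p = mp p (∧-e₁ _ _)

bwd : ∀ {a b} → Pf (a ⇔ b) → Pf (b ⇒ a)
bwd p = mp p (∧-e₂ _ _)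

byCases : ∀ {e g} → Pf (e ∨' ¬' e) → Pf (e ⇒ g) → Pf (¬' e ⇒ g) → Pf g
byCases dec p q = mp dec (either p q)

-- Import for a decidable antecedent: if e ∨ ¬e, then e ⇒ (d ⇒ c) yields
-- e ∧ d ⇒ c (on the ¬e branch the conjunction proves ⊥).
importDec : ∀ {e d c} → Pf (e ∨' ¬' e) → Pf (e ⇒ (d ⇒ c)) → Pf (e ∧' d ⇒ c)
importDec {e} {d} {c} dec p =
  byCases dec (chain p (precompose (∧-e₂ e d))) (pref (∧-e₁ e d) (⊥-ax c))

importDec′ : ∀ {e d c} → Pf (e ∨' ¬' e) → Pf (e ⇒ (d ⇒ c)) → Pf (d ∧' e ⇒ c)
importDec′ {e} {d} {c} dec p =
  byCases dec (chain p (precompose (∧-e₁ d e))) (pref (∧-e₂ d e) (⊥-ax c))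

-- avoid t φ : no variable bound anywhere in φ occurs in t.  This is a
-- substitution-independent sufficient condition for t being free for x.
avoid : Term → Fm → Bool
avoid t (φ ⇒ ψ)  = avoid t φ ∧ avoid t ψ
avoid t (φ ∧' ψ) = avoid t φ ∧ avoid t ψ
avoid t (φ ∨' ψ) = avoid t φ ∧ avoid t ψ
avoid t (∀' y φ) = not (occT y t) ∧ avoid t φ
avoid t (∃' y φ) = not (occT y t) ∧ avoid t φ
avoid t _        = true

∧-true : ∀ {a b} → a ∧ b ≡ true → (a ≡ true) × (b ≡ true)
∧-true {true} {true} refl = refl , refl

avoid⇒substitutable : ∀ t x φ → avoid t φ ≡ true → substitutable t x φ ≡ true
avoid⇒substitutable t x (φ ⇒ ψ) e with ∧-true {avoid t φ} e
... | p , q rewrite avoid⇒substitutable t x φ p | avoid⇒substitutable t x ψ q = refl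
avoid⇒substitutable t x (φ ∧' ψ) e with ∧-true {avoid t φ} e
... | p , q rewrite avoid⇒substitutable t x φ p | avoid⇒substitutable t x ψ q = refl
avoid⇒substitutable t x (φ ∨' ψ) e with ∧-true {avoid t φ} e
... | p , q rewrite avoid⇒substitutable t x φ p | avoid⇒substitutable t x ψ q = refl
avoid⇒substitutable t x (∀' y φ) e with ∧-true {not (occT y t)} e
... | p , q rewrite p | avoid⇒substitutable t x φ q = ∨-zeroʳ _
avoid⇒substitutable t x (∃' y φ) e with ∧-true {not (occT y t)} e
... | p , q rewrite p | avoid⇒substitutable t x φ q = ∨-zeroʳ _
avoid⇒substitutable t x (_ ≐ _)   e = refl
avoid⇒substitutable t x (_ ≼ _)   e = refl
avoid⇒substitutable t x (A _ _ _) e = refl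
avoid⇒substitutable t x (M _ _ _) e = refl
avoid⇒substitutable t x ⊥'        e = refl

-- Substitution creates no new binders, so it preserves avoidance.
avoid-sub : ∀ t x s φ → avoid t φ ≡ true → avoid t (sub x s φ) ≡ true
avoid-sub t x s (φ ⇒ ψ) e with ∧-true {avoid t φ} e
... | p , q rewrite avoid-sub t x s φ p | avoid-sub t x s ψ q = refl
avoid-sub t x s (φ ∧' ψ) e with ∧-true {avoid t φ} e
... | p , q rewrite avoid-sub t x s φ p | avoid-sub t x s ψ q = refl
avoid-sub t x s (φ ∨' ψ) e with ∧-true {avoid t φ} e
... | p , q rewrite avoid-sub t x s φ p | avoid-sub t x s ψ q = refl
avoid-sub t x s (∀' y φ) e with y ≡ᵇ x
... | true = e
... | false with ∧-true {not (occT y t)} e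
... | p , q rewrite p | avoid-sub t x s φ q = refl
avoid-sub t x s (∃' y φ) e with y ≡ᵇ x
... | true = e
... | false with ∧-true {not (occT y t)} e
... | p , q rewrite p | avoid-sub t x s φ q = refl
avoid-sub t x s (_ ≐ _)   e = refl
avoid-sub t x s (_ ≼ _)   e = refl
avoid-sub t x s (A _ _ _) e = refl
avoid-sub t x s (M _ _ _) e = refl
avoid-sub t x s ⊥'        e = refl

substT-fresh : ∀ x t s → occT x s ≡ false → substT x t s ≡ s
substT-fresh x t (var y) e rewrite e = refl
substT-fresh x t 𝟘       e = refl
substT-fresh x t (S s)   e = cong S (substT-fresh x t s e)

occT-num : ∀ x n → occT x (num n) ≡ false
occT-num x zero    = refl
occT-num x (suc n) = occT-num x n

substT-num : ∀ x t n → substT x t (num n) ≡ num n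
substT-num x t n = substT-fresh x t (num n) (occT-num x n)

avoid-num : ∀ n φ → avoid (num n) φ ≡ true
avoid-num n (φ ⇒ ψ)  rewrite avoid-num n φ | avoid-num n ψ = refl
avoid-num n (φ ∧' ψ) rewrite avoid-num n φ | avoid-num n ψ = refl
avoid-num n (φ ∨' ψ) rewrite avoid-num n φ | avoid-num n ψ = refl
avoid-num n (∀' y φ) rewrite occT-num y n | avoid-num n φ = refl
avoid-num n (∃' y φ) rewrite occT-num y n | avoid-num n φ = refl
avoid-num n (_ ≐ _)   = refl
avoid-num n (_ ≼ _)   = refl
avoid-num n (A _ _ _) = refl
avoid-num n (M _ _ _) = refl
avoid-num n ⊥'        = refl

avoid-upTo : ∀ t s n → avoid t (upToDisj s n) ≡ true
avoid-upTo t s zero = refl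
avoid-upTo t s (suc n) rewrite avoid-upTo t s n = refl

sub-upTo : ∀ x t s n → sub x t (upToDisj s n) ≡ upToDisj (substT x t s) n
sub-upTo x t s zero = refl
sub-upTo x t s (suc n) rewrite sub-upTo x t s n | substT-num x t (suc n) = refl

free-upTo : ∀ x s n → occT x s ≡ false → free x (upToDisj s n) ≡ false
free-upTo x s zero e rewrite e = refl
free-upTo x s (suc n) e rewrite free-upTo x s n e | e | occT-num x n = refl

-- From ⊢ φ infer ⊢ φ[t/x]: generalise (⊥ ⇒ φ) to (⊥ ⇒ ∀x φ), then instantiate.
instantiate : ∀ x t {φ ψ} → avoid t φ ≡ true → sub x t φ ≡ ψ → Pf φ → Pf ψ
instantiate x t {φ} a refl p =
  mp (mp (id-ax ⊥') (∀-gen x _ (weaken p)))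
     (∀-inst x φ t (Equivalence.from T-≡ (avoid⇒substitutable t x φ a)))

instantiateNum : ∀ x n {φ ψ} → sub x (num n) φ ≡ ψ → Pf φ → Pf ψ
instantiateNum x n {φ} = instantiate x (num n) (avoid-num n φ)

∃-witness : ∀ x φ t {ψ} → avoid t φ ≡ true → sub x t φ ≡ ψ → Pf (ψ ⇒ ∃' x φ)
∃-witness x φ t a refl = ∃-intro x φ t (Equivalence.from T-≡ (avoid⇒substitutable t x φ a))

∃-elim : ∀ x {χ ψ} → free x χ ≡ false → Pf (ψ ⇒ χ) → Pf (∃' x ψ ⇒ χ)
∃-elim x e p = ∃-gen x (Equivalence.from T-not-≡ e) p

eqRefl : ∀ t → Pf (t ≐ t)
eqRefl t = instantiate 0 t refl refl (eq-refl 0)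

eqSym : ∀ t s → occT 11 t ≡ false → Pf (t ≐ s ⇒ s ≐ t)
eqSym t s f = instantiate 11 s refl e (instantiate 10 t refl refl (eq-sym 10 11))
  where e : sub 11 s (t ≐ var 11 ⇒ var 11 ≐ t) ≡ (t ≐ s ⇒ s ≐ t)
        e rewrite substT-fresh 11 s t f = refl

eqTrans : ∀ t s r → occT 11 t ≡ false → occT 12 t ≡ false → occT 12 s ≡ false →
          Pf (t ≐ s ⇒ (s ≐ r ⇒ t ≐ r))
eqTrans t s r f1 f2 f3 =
  instantiate 12 r refl e2 (instantiate 11 s refl e1 (instantiate 10 t refl refl (eq-trans 10 11 12)))
  where e1 : sub 11 s (t ≐ var 11 ⇒ (var 11 ≐ var 12 ⇒ t ≐ var 12)) ≡ (t ≐ s ⇒ (s ≐ var 12 ⇒ t ≐ var 12))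
        e1 rewrite substT-fresh 11 s t f1 = refl
        e2 : sub 12 r (t ≐ s ⇒ (s ≐ var 12 ⇒ t ≐ var 12)) ≡ (t ≐ s ⇒ (s ≐ r ⇒ t ≐ r))
        e2 rewrite substT-fresh 12 r t f2 | substT-fresh 12 r s f3 = refl

congS : ∀ t s → occT 11 t ≡ false → Pf (t ≐ s ⇒ S t ≐ S s)
congS t s f = instantiate 11 s refl e (instantiate 10 t refl refl (eq-term 10 11 (S (var 10))))
  where e : sub 11 s (t ≐ var 11 ⇒ S t ≐ S (var 11)) ≡ (t ≐ s ⇒ S t ≐ S s)
        e rewrite substT-fresh 11 s t f = refl

sInj : ∀ t s → occT 11 t ≡ false → Pf (S t ≐ S s ⇒ t ≐ s)
sInj t s f = instantiate 11 s refl e (instantiate 10 t refl refl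
               (instantiate 1 (var 11) refl refl (instantiate 0 (var 10) refl refl (ax Q-Sinj))))
  where e : sub 11 s (S t ≐ S (var 11) ⇒ t ≐ var 11) ≡ (S t ≐ S s ⇒ t ≐ s)
        e rewrite substT-fresh 11 s t f = refl

eqDec : ∀ t s → occT 11 t ≡ false → Pf (t ≐ s ∨' t ≠ s)
eqDec t s f = instantiate 11 s refl e (instantiate 10 t refl refl
                (instantiate 1 (var 11) refl refl (instantiate 0 (var 10) refl refl (ax Q-dec))))
  where e : sub 11 s (t ≐ var 11 ∨' t ≠ var 11) ≡ (t ≐ s ∨' t ≠ s)
        e rewrite substT-fresh 11 s t f = refl

succ≠0 : ∀ t → Pf (S t ≐ 𝟘 ⇒ ⊥')
succ≠0 t = instantiate 0 t refl refl (ax Q-S0)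

0≠succ : ∀ t → Pf (𝟘 ≐ S t ⇒ ⊥')
0≠succ t = chain (eqSym 𝟘 (S t) refl) (succ≠0 t)

numNeq : ∀ m n → ¬ (m ≡ n) → Pf (num m ≠ num n)
numNeq zero    zero    m≢n with m≢n refl
... | ()
numNeq zero    (suc n) m≢n = 0≠succ (num n)
numNeq (suc m) zero    m≢n = succ≠0 (num m)
numNeq (suc m) (suc n) m≢n =
  chain (sInj (num m) (num n) (occT-num 11 m)) (numNeq m n (λ e → m≢n (cong suc e)))

addSucc : ∀ m n → Pf (A (num m) (S (num n)) vx ⇔ ∃' 3 (A (num m) (num n) vu ∧' vx ≐ S vu))
addSucc m n = instantiateNum 11 n e (instantiateNum 10 m refl
                (instantiate 2 vx refl refl (instantiate 1 (var 11) refl refl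
                  (instantiate 0 (var 10) refl refl (ax Q-AS)))))
  where e : sub 11 (num n) (A (num m) (S (var 11)) vx ⇔ ∃' 3 (A (num m) (var 11) vu ∧' vx ≐ S vu))
            ≡ (A (num m) (S (num n)) vx ⇔ ∃' 3 (A (num m) (num n) vu ∧' vx ≐ S vu))
        e rewrite substT-num 11 (num n) m = refl

addAtTerm : ∀ m n t → Pf (A (num m) (num n) vx ⇔ num (m + n) ≐ vx) →
            Pf (A (num m) (num n) t ⇔ num (m + n) ≐ t)
addAtTerm m n t p = instantiate 0 t refl e p
  where e : sub 0 t (A (num m) (num n) vx ⇔ num (m + n) ≐ vx) ≡ (A (num m) (num n) t ⇔ num (m + n) ≐ t)
        e rewrite substT-num 0 t m | substT-num 0 t n | substT-num 0 t (m + n) = refl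

-- Forward: a witness u with A(m̄,n̄,u) equals m+n, so x = S u = m+n+1; the
-- conjunction is imported because u = m+n is decidable.
-- Backward: the witness u := m+n.
addNum : ∀ m n → Pf (A (num m) (num n) vx ⇔ num (m + n) ≐ vx)
addNum m zero rewrite +-identityʳ m =
  instantiate 10 (num m) refl refl (instantiate 1 vx refl refl
    (instantiate 0 (var 10) refl refl (ax Q-A0)))
addNum m (suc n) rewrite +-suc m n =
  adj (chain (fwd (addSucc m n)) forward) (chain backward (bwd (addSucc m n)))
  where
    k = m + n
    fk = occT-num 11 k
    succEq : Pf (num k ≐ vu ⇒ (vx ≐ S vu ⇒ S (num k) ≐ vx))
    succEq = chain (congS (num k) vu fk)
                   (chain (eqTrans (S (num k)) (S vu) vx fk (occT-num 12 k) refl)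
                          (precompose (eqSym vx (S vu) refl)))
    forward : Pf (∃' 3 (A (num m) (num n) vu ∧' vx ≐ S vu) ⇒ S (num k) ≐ vx)
    forward = ∃-elim 3 fr (chain (∧-map (fwd (addAtTerm m n vu (addNum m n))) (id-ax _))
                                 (importDec (eqDec (num k) vu fk) succEq))
      where fr : free 3 (S (num k) ≐ vx) ≡ false
            fr rewrite occT-num 3 k = refl
    closed : Pf (A (num m) (num n) (num k))
    closed = mp (eqRefl (num k)) (bwd (addAtTerm m n (num k) (addNum m n)))
    backward : Pf (S (num k) ≐ vx ⇒ ∃' 3 (A (num m) (num n) vu ∧' vx ≐ S vu))
    backward = chain (both (weaken closed) (eqSym (S (num k)) vx fk)) (∃-witness 3 _ (num k) refl e)
      where e : sub 3 (num k) (A (num m) (num n) vu ∧' vx ≐ S vu) ≡ (A (num m) (num n) (num k) ∧' vx ≐ S (num k))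
            e rewrite substT-num 3 (num k) m | substT-num 3 (num k) n = refl

addNumAt : ∀ m n t → Pf (A (num m) (num n) t ⇔ num (m + n) ≐ t)
addNumAt m n t = addAtTerm m n t (addNum m n)

addClosed : ∀ j k → Pf (A (num j) (num k) (num (j + k)))
addClosed j k = mp (eqRefl (num (j + k))) (bwd (addNumAt j k (num (j + k))))

mulZero : ∀ m → Pf (M (num m) 𝟘 vx ⇔ vx ≐ 𝟘)
mulZero m = instantiate 10 (num m) refl refl (instantiate 1 vx refl refl
              (instantiate 0 (var 10) refl refl (ax Q-M0)))

mulSucc : ∀ m n → Pf (M (num m) (S (num n)) vx ⇒ ∃' 3 (M (num m) (num n) vu ∧' A vu (num m) vx))
mulSucc m n = instantiateNum 11 n e (instantiateNum 10 m refl
                (instantiate 2 vx refl refl (instantiate 1 (var 11) refl refl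
                  (instantiate 0 (var 10) refl refl (ax Q-MS)))))
  where e : sub 11 (num n) (M (num m) (S (var 11)) vx ⇒ ∃' 3 (M (num m) (var 11) vu ∧' A vu (num m) vx))
            ≡ (M (num m) (S (num n)) vx ⇒ ∃' 3 (M (num m) (num n) vu ∧' A vu (num m) vx))
        e rewrite substT-num 11 (num n) m = refl

mulNumSucc : ∀ m n k → Pf (M (num m) (num n) (num k) ⇒ (A (num k) (num m) vx ⇒ M (num m) (num (suc n)) vx))
mulNumSucc m n k = instantiateNum 3 k e (ax (Q-Mnum m n))
  where e : sub 3 (num k) (M (num m) (num n) vu ⇒ (A vu (num m) vx ⇒ M (num m) (num (suc n)) vx))
            ≡ (M (num m) (num n) (num k) ⇒ (A (num k) (num m) vx ⇒ M (num m) (num (suc n)) vx))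
        e rewrite substT-num 3 (num k) m | substT-num 3 (num k) n = refl

mulAtTerm : ∀ m n t → Pf (M (num m) (num n) vx ⇔ num (m * n) ≐ vx) →
            Pf (M (num m) (num n) t ⇔ num (m * n) ≐ t)
mulAtTerm m n t p = instantiate 0 t refl e p
  where e : sub 0 t (M (num m) (num n) vx ⇔ num (m * n) ≐ vx) ≡ (M (num m) (num n) t ⇔ num (m * n) ≐ t)
        e rewrite substT-num 0 t m | substT-num 0 t n | substT-num 0 t (m * n) = refl

-- With k = m·n: forward, the witness u of Q-MS equals k̄, so A(k̄, m̄, x) and R-add
-- give x = k+m; backward, R-add gives A(k̄, m̄, x) and Q-Mnum concludes.
mulNum : ∀ m n → Pf (M (num m) (num n) vx ⇔ num (m * n) ≐ vx)
mulNum m zero rewrite *-zeroʳ m =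
  adj (chain (fwd (mulZero m)) (eqSym vx 𝟘 refl)) (chain (eqSym 𝟘 vx refl) (bwd (mulZero m)))
mulNum m (suc n) = subst (λ j → Pf (M (num m) (num (suc n)) vx ⇔ num j ≐ vx)) k+m≡m*sn
                         (adj forward backward)
  where
    k = m * n
    k+m≡m*sn : k + m ≡ m * suc n
    k+m≡m*sn = trans (+-comm k m) (sym (*-suc m n))
    fk = occT-num 11 k
    replaceU : Pf (num k ≐ vu ⇒ (A vu (num m) vx ⇒ A (num k) (num m) vx))
    replaceU = chain (eqSym (num k) vu fk)
                     (instantiateNum 12 m e (instantiate 10 (num k) refl refl (eq-leib 3 10 (A vu (var 12) vx) _)))
      where e : sub 12 (num m) (vu ≐ num k ⇒ (A vu (var 12) vx ⇒ A (num k) (var 12) vx))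
                ≡ (vu ≐ num k ⇒ (A vu (num m) vx ⇒ A (num k) (num m) vx))
            e rewrite substT-num 12 (num m) k = refl
    forward : Pf (M (num m) (num (suc n)) vx ⇒ num (k + m) ≐ vx)
    forward = chain (mulSucc m n) (∃-elim 3 fr
                (chain (∧-map (fwd (mulAtTerm m n vu (mulNum m n))) (id-ax _))
                       (chain (importDec (eqDec (num k) vu fk) replaceU) (fwd (addNumAt k m vx)))))
      where fr : free 3 (num (k + m) ≐ vx) ≡ false
            fr rewrite occT-num 3 (k + m) = refl
    closed : Pf (M (num m) (num n) (num k))
    closed = mp (eqRefl (num k)) (bwd (mulAtTerm m n (num k) (mulNum m n)))
    backward : Pf (num (k + m) ≐ vx ⇒ M (num m) (num (suc n)) vx)
    backward = chain (bwd (addNumAt k m vx)) (mp closed (mulNumSucc m n k))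

zeroInDisj : ∀ t n → Pf (t ≐ 𝟘 ⇒ upToDisj t n)
zeroInDisj t zero    = id-ax _
zeroInDisj t (suc n) = chain (zeroInDisj t n) (∨-i₁ _ _)

disjSucc : ∀ t n → occT 11 t ≡ false → Pf (upToDisj t n ⇒ upToDisj (S t) (suc n))
disjSucc t zero    f = chain (congS t 𝟘 f) (∨-i₂ _ _)
disjSucc t (suc n) f = either (chain (disjSucc t n f) (∨-i₁ _ _)) (chain (congS t (num (suc n)) f) (∨-i₂ _ _))

disjPred : ∀ t n → occT 11 t ≡ false → Pf (upToDisj (S t) (suc n) ⇒ upToDisj t n)
disjPred t zero    f = either (chain (succ≠0 t) (⊥-ax _)) (sInj t 𝟘 f)
disjPred t (suc n) f = either (chain (disjPred t n f) (∨-i₁ _ _)) (chain (sInj t (num (suc n)) f) (∨-i₂ _ _))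

substT-twice : ∀ x s t a → occT x t ≡ false → substT x s (substT x t a) ≡ substT x t a
substT-twice x s t (var y) f with x ≡ᵇ y in eq
... | true  = substT-fresh x s t f
... | false rewrite eq = refl
substT-twice x s t 𝟘     f = refl
substT-twice x s t (S a) f = cong S (substT-twice x s t a f)

sub-twice : ∀ x s t φ → occT x t ≡ false → sub x s (sub x t φ) ≡ sub x t φ
sub-twice x s t (a ≐ b)   f rewrite substT-twice x s t a f | substT-twice x s t b f = refl
sub-twice x s t (a ≼ b)   f rewrite substT-twice x s t a f | substT-twice x s t b f = refl
sub-twice x s t (A a b c) f
  rewrite substT-twice x s t a f | substT-twice x s t b f | substT-twice x s t c f = refl
sub-twice x s t (M a b c) f
  rewrite substT-twice x s t a f | substT-twice x s t b f | substT-twice x s t c f = refl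
sub-twice x s t ⊥'        f = refl
sub-twice x s t (φ ⇒ ψ)   f rewrite sub-twice x s t φ f | sub-twice x s t ψ f = refl
sub-twice x s t (φ ∧' ψ)  f rewrite sub-twice x s t φ f | sub-twice x s t ψ f = refl
sub-twice x s t (φ ∨' ψ)  f rewrite sub-twice x s t φ f | sub-twice x s t ψ f = refl
sub-twice x s t (∀' y φ)  f with y ≡ᵇ x in eq
... | true  rewrite eq = refl
... | false rewrite eq = cong (∀' y) (sub-twice x s t φ f)
sub-twice x s t (∃' y φ)  f with y ≡ᵇ x in eq
... | true  rewrite eq = refl
... | false rewrite eq = cong (∃' y) (sub-twice x s t φ f)

-- For a property φ of the placeholder variable 10 (with y not free in φ(x)):
-- φ(x) follows from x = 0 ⇒ φ(x) and from φ(S y).  By decidability x = 0 or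
-- x ≠ 0; in the latter case Q-pred gives x = S y and Leibniz transports φ(S y).
zeroOrSucc : ∀ φ {G} → sub 10 vx φ ≡ G → free 1 G ≡ false →
             avoid vx φ ≡ true → avoid (S vy) φ ≡ true →
             Pf (vx ≐ 𝟘 ⇒ G) → Pf (sub 10 (S vy) φ) → Pf G
zeroOrSucc φ refl fr avoidX avoidSy zeroCase succCase =
  byCases (eqDec vx 𝟘 refl) zeroCase
    (chain (ax Q-pred) (∃-elim 1 fr (chain (eqSym vx (S vy) refl) transport)))
  where
    leibniz : Pf (var 10 ≐ vx ⇒ (φ ⇒ sub 10 vx φ))
    leibniz = eq-leib 10 0 φ (Equivalence.from T-≡ (avoid⇒substitutable vx 10 φ avoidX))
    avoidLeibniz : avoid (S vy) (var 10 ≐ vx ⇒ (φ ⇒ sub 10 vx φ)) ≡ true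
    avoidLeibniz rewrite avoidSy | avoid-sub (S vy) 10 vx φ avoidSy = refl
    atSucc : sub 10 (S vy) (var 10 ≐ vx ⇒ (φ ⇒ sub 10 vx φ))
             ≡ (S vy ≐ vx ⇒ (sub 10 (S vy) φ ⇒ sub 10 vx φ))
    atSucc = cong (λ ψ → S vy ≐ vx ⇒ (sub 10 (S vy) φ ⇒ ψ)) (sub-twice 10 (S vy) vx φ refl)
    transport : Pf (S vy ≐ vx ⇒ sub 10 vx φ)
    transport = discharge (instantiate 10 (S vy) avoidLeibniz atSucc leibniz) succCase

leDef : ∀ n → Pf (vx ≼ num n ⇔ ∃' 2 (A vz vx (num n)))
leDef n = instantiateNum 1 n refl (ax Q-le)

-- If k ≤ n then x = k̄ ⇒ x ≤ n̄, with witness z := n ∸ k.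
eqNum⇒le : ∀ k n → k ≤ n → Pf (vx ≐ num k ⇒ vx ≼ num n)
eqNum⇒le k n k≤n =
  chain (eqSym vx (num k) refl) (chain (discharge replaceK sumFact) (chain witness (bwd (leDef n))))
  where
    j = n ∸ k
    sumFact : Pf (A (num j) (num k) (num n))
    sumFact = subst (λ q → Pf (A (num j) (num k) (num q))) (m∸n+n≡m k≤n) (addClosed j k)
    replaceK : Pf (num k ≐ vx ⇒ (A (num j) (num k) (num n) ⇒ A (num j) vx (num n)))
    replaceK = instantiateNum 10 k e (eq-leib 10 0 (A (num j) (var 10) (num n)) _)
      where e : sub 10 (num k) (var 10 ≐ vx ⇒ (A (num j) (var 10) (num n) ⇒
                  A (substT 10 vx (num j)) vx (substT 10 vx (num n))))
                ≡ (num k ≐ vx ⇒ (A (num j) (num k) (num n) ⇒ A (num j) vx (num n)))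
            e rewrite substT-num 10 vx j | substT-num 10 vx n
                    | substT-num 10 (num k) j | substT-num 10 (num k) n = refl
    witness : Pf (A (num j) vx (num n) ⇒ ∃' 2 (A vz vx (num n)))
    witness = ∃-witness 2 _ (num j) refl e
      where e : sub 2 (num j) (A vz vx (num n)) ≡ A (num j) vx (num n)
            e rewrite substT-num 2 (num j) n = refl

disj⇒le : ∀ j n → j ≤ n → Pf (upToDisj vx j ⇒ vx ≼ num n)
disj⇒le zero    n j≤n = eqNum⇒le 0 n z≤n
disj⇒le (suc j) n j≤n = either (disj⇒le j n (<⇒≤ j≤n)) (eqNum⇒le (suc j) n j≤n)

addSuccZ : ∀ n → Pf (A vz (S vy) (num n) ⇔ ∃' 3 (A vz vy vu ∧' num n ≐ S vu))
addSuccZ n = instantiate 0 vz refl e (instantiateNum 2 n refl (ax Q-AS))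
  where e : sub 0 vz (A vx (S vy) (num n) ⇔ ∃' 3 (A vx vy vu ∧' num n ≐ S vu))
            ≡ (A vz (S vy) (num n) ⇔ ∃' 3 (A vz vy vu ∧' num n ≐ S vu))
        e rewrite substT-num 0 vz n = refl

-- The converse direction: z + x = n̄ forces x ∈ {0,…,n}.  Induction on n,
-- splitting x into 0 or S y; for x = S y the recursion axiom reduces
-- A(z, S y, n+1) to A(z, y, n).
sumBound : ∀ n → Pf (A vz vx (num n) ⇒ upToDisj vx n)
sumBoundSucc : ∀ n → Pf (A vz (S vy) (num n) ⇒ upToDisj (S vy) n)

sumBound n =
  zeroOrSucc φ e fr (avoid-upTo vx (var 10) n) (avoid-upTo (S vy) (var 10) n)
    (chain (zeroInDisj vx n) (K-ax _ _)) (subst Pf eS (sumBoundSucc n))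
  where
    φ = A vz (var 10) (num n) ⇒ upToDisj (var 10) n
    e : sub 10 vx φ ≡ (A vz vx (num n) ⇒ upToDisj vx n)
    e rewrite substT-num 10 vx n | sub-upTo 10 vx (var 10) n = refl
    eS : (A vz (S vy) (num n) ⇒ upToDisj (S vy) n) ≡ sub 10 (S vy) φ
    eS rewrite substT-num 10 (S vy) n | sub-upTo 10 (S vy) (var 10) n = refl
    fr : free 1 (A vz vx (num n) ⇒ upToDisj vx n) ≡ false
    fr rewrite occT-num 1 n | free-upTo 1 vx n refl = refl

sumBoundSucc zero =
  chain (fwd (addSuccZ 0)) (∃-elim 3 refl (chain (∧-e₂ _ _) (chain (0≠succ vu) (⊥-ax _))))
sumBoundSucc (suc n) =
  chain (fwd (addSuccZ (suc n))) (∃-elim 3 (free-upTo 3 (S vy) (suc n) refl) witnessCase)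
  where
    fn = occT-num 11 n
    boundY : Pf (A vz vy (num n) ⇒ upToDisj vy n)
    boundY = instantiate 0 vy (avoid-upTo vy vx n) e (sumBound n)
      where e : sub 0 vy (A vz vx (num n) ⇒ upToDisj vx n) ≡ (A vz vy (num n) ⇒ upToDisj vy n)
            e rewrite substT-num 0 vy n | sub-upTo 0 vy vx n = refl
    replaceU : Pf (vu ≐ num n ⇒ (A vz vy vu ⇒ A vz vy (num n)))
    replaceU = instantiateNum 10 n refl (eq-leib 3 10 (A vz vy vu) _)
    fromU : Pf (num n ≐ vu ⇒ (A vz vy vu ⇒ upToDisj (S vy) (suc n)))
    fromU = chain (eqSym (num n) vu fn) (under replaceU (chain boundY (disjSucc vy n refl)))
    witnessCase : Pf (A vz vy vu ∧' S (num n) ≐ S vu ⇒ upToDisj (S vy) (suc n))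
    witnessCase = chain (∧-map (id-ax _) (sInj (num n) vu fn)) (importDec′ (eqDec (num n) vu fn) fromU)

leNum : ∀ n → Pf (vx ≼ num n ⇔ upToDisj vx n)
leNum n = adj (chain (fwd (leDef n)) (∃-elim 2 (free-upTo 2 vx n refl) (sumBound n)))
              (disj⇒le n n ≤-refl)

leNumAt : ∀ t n → Pf (t ≼ num n ⇔ upToDisj t n)
leNumAt t n = instantiate 0 t a e (leNum n)
  where a : avoid t (vx ≼ num n ⇔ upToDisj vx n) ≡ true
        a rewrite avoid-upTo t vx n = refl
        e : sub 0 t (vx ≼ num n ⇔ upToDisj vx n) ≡ (t ≼ num n ⇔ upToDisj t n)
        e rewrite substT-num 0 t n | sub-upTo 0 t vx n = refl

leSucc : ∀ n → Pf (vy ≼ num n ⇒ S vy ≼ num (suc n))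
leSucc n = chain (fwd (leNumAt vy n)) (chain (disjSucc vy n refl) (bwd (leNumAt (S vy) (suc n))))

lePred : ∀ n → Pf (S vy ≼ num (suc n) ⇒ vy ≼ num n)
lePred n = chain (fwd (leNumAt (S vy) (suc n))) (chain (disjPred vy n refl) (bwd (leNumAt vy n)))

-- n̄ ≤ y ⇒ S n̄ ≤ S y: a witness z of z + n = y also witnesses z + (n+1) = S y.
numLeSucc : ∀ n → Pf (num n ≼ vy ⇒ S (num n) ≼ S vy)
numLeSucc n = chain (fwd leN) (chain (∃-elim 2 refl (chain shift (∃-witness 2 _ vz refl eZ))) (bwd leSN))
  where
    leN : Pf (num n ≼ vy ⇔ ∃' 2 (A vz (num n) vy))
    leN = instantiateNum 0 n refl (ax Q-le)
    leSN : Pf (S (num n) ≼ S vy ⇔ ∃' 2 (A vz (S (num n)) (S vy)))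
    leSN = instantiateNum 0 (suc n) refl (instantiate 1 (S vy) refl refl (ax Q-le))
    addSN : Pf (A vz (S (num n)) (S vy) ⇔ ∃' 3 (A vz (num n) vu ∧' S vy ≐ S vu))
    addSN = instantiate 11 vy refl e (instantiateNum 1 n refl (instantiate 0 vz refl refl
              (instantiate 2 (S (var 11)) refl refl (ax Q-AS))))
      where e : sub 11 vy (A vz (S (num n)) (S (var 11)) ⇔ ∃' 3 (A vz (num n) vu ∧' S (var 11) ≐ S vu))
                ≡ (A vz (S (num n)) (S vy) ⇔ ∃' 3 (A vz (num n) vu ∧' S vy ≐ S vu))
            e rewrite substT-num 11 vy n = refl
    shift : Pf (A vz (num n) vy ⇒ A vz (S (num n)) (S vy))
    shift = chain (both (id-ax _) (weaken (eqRefl (S vy))))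
                  (chain (∃-witness 3 (A vz (num n) vu ∧' S vy ≐ S vu) vy refl eU) (bwd addSN))
      where eU : sub 3 vy (A vz (num n) vu ∧' S vy ≐ S vu) ≡ (A vz (num n) vy ∧' S vy ≐ S vy)
            eU rewrite substT-num 3 vy n = refl
    eZ : sub 2 vz (A vz (S (num n)) (S vy)) ≡ A vz (S (num n)) (S vy)
    eZ rewrite substT-num 2 vz n = refl

-- 0 ≤ x, with witness z := x.
zeroLe : Pf (𝟘 ≼ vx)
zeroLe = mp sumX0 (chain (∃-witness 2 (A vz 𝟘 vx) vx refl refl) (bwd le0))
  where
    le0 : Pf (𝟘 ≼ vx ⇔ ∃' 2 (A vz 𝟘 vx))
    le0 = instantiate 11 vx refl refl (instantiate 0 𝟘 refl refl (instantiate 1 (var 11) refl refl (ax Q-le)))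
    sumX0 : Pf (A vx 𝟘 vx)
    sumX0 = mp (eqRefl vx) (bwd (instantiate 1 vx refl refl (ax Q-A0)))

-- For x = S y the induction hypothesis at y is lifted by leSucc / numLeSucc.
leTotal : ∀ n → Pf (vx ≼ num n ∨' num n ≼ vx)
leTotal zero    = mp zeroLe (∨-i₂ _ _)
leTotal (suc n) =
  zeroOrSucc φ e fr refl refl (chain (eqNum⇒le 0 (suc n) z≤n) (∨-i₁ _ _)) (subst Pf eS succCase)
  where
    φ = var 10 ≼ num (suc n) ∨' num (suc n) ≼ var 10
    e : sub 10 vx φ ≡ (vx ≼ num (suc n) ∨' num (suc n) ≼ vx)
    e rewrite substT-num 10 vx n = refl
    eS : (S vy ≼ num (suc n) ∨' num (suc n) ≼ S vy) ≡ sub 10 (S vy) φ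
    eS rewrite substT-num 10 (S vy) n = refl
    fr : free 1 (vx ≼ num (suc n) ∨' num (suc n) ≼ vx) ≡ false
    fr rewrite occT-num 1 n = refl
    totalY : Pf (vy ≼ num n ∨' num n ≼ vy)
    totalY = instantiate 0 vy refl eY (leTotal n)
      where eY : sub 0 vy (vx ≼ num n ∨' num n ≼ vx) ≡ (vy ≼ num n ∨' num n ≼ vy)
            eY rewrite substT-num 0 vy n = refl
    succCase : Pf (S vy ≼ num (suc n) ∨' num (suc n) ≼ S vy)
    succCase = mp totalY (either (chain (leSucc n) (∨-i₁ _ _)) (chain (numLeSucc n) (∨-i₂ _ _)))

-- For x = S y: S y ≤ 0 is refuted, and S y ≤ n+1 is equivalent to y ≤ n.
leDec : ∀ n → Pf (vx ≼ num n ∨' ¬' (vx ≼ num n))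
leDecSucc : ∀ n → Pf (S vy ≼ num n ∨' ¬' (S vy ≼ num n))

leDec n = zeroOrSucc φ e fr refl refl (chain (eqNum⇒le 0 n z≤n) (∨-i₁ _ _)) (subst Pf eS (leDecSucc n))
  where
    φ = var 10 ≼ num n ∨' ¬' (var 10 ≼ num n)
    e : sub 10 vx φ ≡ (vx ≼ num n ∨' ¬' (vx ≼ num n))
    e rewrite substT-num 10 vx n = refl
    eS : (S vy ≼ num n ∨' ¬' (S vy ≼ num n)) ≡ sub 10 (S vy) φ
    eS rewrite substT-num 10 (S vy) n = refl
    fr : free 1 (vx ≼ num n ∨' ¬' (vx ≼ num n)) ≡ false
    fr rewrite occT-num 1 n = refl

leDecSucc zero    = mp (chain (fwd (leNumAt (S vy) 0)) (succ≠0 vy)) (∨-i₂ _ _)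
leDecSucc (suc n) = mp decY (either (chain (leSucc n) (∨-i₁ _ _)) (chain (precompose (lePred n)) (∨-i₂ _ _)))
  where decY : Pf (vy ≼ num n ∨' ¬' (vy ≼ num n))
        decY = instantiate 0 vy refl e (leDec n)
          where e : sub 0 vy (vx ≼ num n ∨' ¬' (vx ≼ num n)) ≡ (vy ≼ num n ∨' ¬' (vy ≼ num n))
                e rewrite substT-num 0 vy n = refl

mainTheorem3 : ∀ φ → RAx φ → QAx ⊢ φ
mainTheorem3 _ (R-add m n)      = addNum m n
mainTheorem3 _ (R-mul m n)      = mulNum m n
mainTheorem3 _ (R-neq m n m≢n)  = numNeq m n m≢n
mainTheorem3 _ (R-le n)         = leNum n
mainTheorem3 _ (R-tot n)        = leTotal n
mainTheorem3 _ (R-dec n)        = leDec n
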